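{- Let $n, k, r$ be positive integers with $r\le k$, and suppose there is an $r$-independent collection of $k$ subsets of an $n$-element set. Let $G$ be a finite graph with $\chi(G) = h \leq 2^k$, and let $\mathcal F_G$ be a collection of pairs $(v,S)$ with $v \in V(G)$, $S \subseteq V(G)$ consisting only of neighbours of $v$, and $|S| \leq r$ for each pair. Then, for some identification of $V(G)$ with $\{1,\dots,|V(G)|\}$, there is a $(G,n,\mathcal F_G)$-independent system.
   Context: Subsets $A_1,\dots,A_k$ of an $n$-element set $Q$ are $k$-independent if all $2^k$ intersections $B_1\cap\cdots\cap B_k$, where each $B_j$ is either $A_j$ or its complement $Q\setminus A_j$, are nonempty. A collection of $m\ge k$ subsets is $k$-independent if every $k$-element subcollection is $k$-independent. For $G$ with vertices identified with $\{1,\dots,|V(G)|\}$, a positive integer $n$, and a collection $\mathcal F_G$ of pairs $(v,S)$ with $v\in V(G)$ and $S$ a set of neighbours of $v$, a family $\{A_{u,v}\}$ indexed by edges $(u,v)\in E(G)$ with $u<v$, each $A_{u,v}\subseteq[n]$, is $(G,n,\mathcal F_G)$-independent if for every $(v,S)\in\mathcal F_G$: if $v>\min S$ then $\bigcap_{u\in S,\,u<v}A_{u,v}\setminus\bigcup_{w\in S,\,w>v}A_{v,w}\neq\emptyset$, and if $v<\min S$ (or $S=\emptyset$) then $[n]\setminus\bigcup_{w\in S,\,w>v}A_{v,w}\neq\emptyset$. -}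

module Defs where

open import Level using (0ℓ)
open import Data.Nat using (ℕ; _≤_)
open import Data.Fin using (Fin) renaming (_<_ to _<ᶠ_)
open import Data.Fin.Subset using (Subset; _∈_; _∉_)
open import Data.Fin.Permutation using (Permutation′; _⟨$⟩ʳ_)
open import Data.Bool using (Bool; true)
open import Data.Product using (Σ; ∃; _×_)
open import Function using (Injective)
open import Relation.Binary.PropositionalEquality using (_≡_; _≢_)
open import Relation.Nullary using (¬_)

record Graph (N : ℕ) : Set₁ where
  field
    Adj     : Fin N → Fin N → Set
    sym     : ∀ {u v} → Adj u v → Adj v u
    irrefl  : ∀ {v} → ¬ Adj v v
open Graph public

Colourable : ∀ {N} → Graph N → ℕ → Set
Colourable {N} G c = Σ (Fin N → Fin c) λ col → ∀ u v → Adj G u v → col u ≢ col v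

IsChromaticNumber : ∀ {N} → Graph N → ℕ → Set
IsChromaticNumber G h = Colourable G h × (∀ m → Colourable G m → h ≤ m)

IndependentAt : ∀ {n m k} → (Fin m → Subset n) → (Fin k → Fin m) → Set
IndependentAt {n} {m} {k} A ι =
  (b : Fin k → Bool) → ∃ λ (x : Fin n) → ∀ j → (x ∈ A (ι j) → b j ≡ true) × (b j ≡ true → x ∈ A (ι j))

RIndependentCollection : ∀ {n m} → (r : ℕ) → (Fin m → Subset n) → Set
RIndependentCollection {n} {m} r A =
  (ι : Fin r → Fin m) → Injective _≡_ _≡_ ι → IndependentAt A ι

-- The (G,n,F)-independence condition, relative to an identification
-- σ of V(G) with {1,…,|V(G)|} (order u ≺ v iff σ u < σ v).
-- A u v is the set A_{u,v} (only used for edges with u ≺ v).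
module _ {N : ℕ} (σ : Permutation′ N) where
  _≺_ : Fin N → Fin N → Set
  u ≺ v = (σ ⟨$⟩ʳ u) <ᶠ (σ ⟨$⟩ʳ v)

  AboveMin : Fin N → Subset N → Set
  AboveMin v S = ∃ λ u → u ∈ S × u ≺ v

  IndependentSystem : (n : ℕ) → (F : Fin N → Subset N → Set) →
                      (Fin N → Fin N → Subset n) → Set
  IndependentSystem n F A = ∀ v S → F v S →
    (AboveMin v S → ∃ λ (x : Fin n) →
        (∀ u → u ∈ S → u ≺ v → x ∈ A u v) × (∀ w → w ∈ S → v ≺ w → x ∉ A v w))
    × (¬ AboveMin v S → ∃ λ (x : Fin n) → ∀ w → w ∈ S → v ≺ w → x ∉ A v w)

-- Colour G properly with k-bit vectors (possible as χ(G) ≤ 2^k) and attach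
-- to every edge a coordinate on which the colours of its ends differ.  For u < v let A_{u,v} be
-- B_t or its complement according to bit t of the colour of v, t the coordinate of uv.  Given
-- (v,S), the edges from v to S carry at most r coordinates, so r-independence yields a point
-- following the colour of v on all of them: it lies in A_{u,v} for u < v, and outside A_{v,w}
-- for v < w because the colour of w has the opposite bit there.
module Submission where

open import Defs hiding (sym)
open import Data.Nat using (ℕ; zero; suc; s≤s; _≤_; _<_; _^_; NonZero; >-nonZero⁻¹)
open import Data.Nat.Properties using (<⇒≤; <⇒≱)
open import Data.Fin using (Fin; zero; suc; inject≤; fromℕ<; finToFun; funToFin; combine)
  renaming (_<_ to _<ᶠ_)
open import Data.Fin.Properties
  using (any?; _<?_; <-asym; ¬∀⟶∃¬; injective⇒≤; inject≤-injective; funToFin-finToFin; 2↔Bool)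
  renaming (_≟_ to _≟ᶠ_)
open import Data.Fin.Subset using (Subset; _∈_; _∉_; ∁; ∣_∣; outside; inside)
open import Data.Fin.Subset.Properties using (x∈∁p⇒x∉p; x∉p⇒x∈∁p)
open import Data.Fin.Permutation using (Permutation′)
import Data.Fin.Permutation as Permutation
open import Data.Vec using ([]; _∷_; here; there)
open import Data.Vec.Functional as Vector using ()
open import Data.Bool using (Bool; true; false; if_then_else_) renaming (_≟_ to _≟ᵇ_)
open import Data.Product using (∃; _×_; _,_; proj₁; proj₂)
open import Data.Empty using (⊥-elim)
open import Function using (Injective; Injection; _∘_; const; case_of_)
open import Function.Properties.Inverse using (↔⇒↣)
open import Relation.Nullary using (¬_; yes; no; ¬?)
open import Relation.Binary.PropositionalEquality
  using (_≡_; _≢_; _≗_; refl; sym; trans; cong; cong₂; subst; module ≡-Reasoning)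

missedPoint : ∀ {a k} → a < k → (ι : Fin a → Fin k) → ∃ λ z → ¬ ∃ λ i → ι i ≡ z
missedPoint {k = k} a<k ι = ¬∀⟶∃¬ k _ (λ z → any? λ i → ι i ≟ᶠ z) not-onto
  where
  not-onto : ¬ (∀ z → ∃ λ i → ι i ≡ z)
  not-onto onto = <⇒≱ a<k (injective⇒≤ preimage-injective)
    where
    preimage-injective : Injective _≡_ _≡_ (proj₁ ∘ onto)
    preimage-injective {z} {z′} e =
      trans (sym (proj₂ (onto z))) (trans (cong ι e) (proj₂ (onto z′)))

∷-injective : ∀ {a k} {z : Fin k} {ι : Fin a → Fin k} → Injective _≡_ _≡_ ι →
              (¬ ∃ λ i → ι i ≡ z) → Injective _≡_ _≡_ (z Vector.∷ ι)
∷-injective ι-inj z∉ι {zero}  {zero}  _ = refl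
∷-injective ι-inj z∉ι {zero}  {suc j} e = ⊥-elim (z∉ι (j , sym e))
∷-injective ι-inj z∉ι {suc i} {zero}  e = ⊥-elim (z∉ι (i , e))
∷-injective ι-inj z∉ι {suc i} {suc j} e = cong suc (ι-inj e)

extendingPoint : ∀ {a k} → a < k → (ι : Fin a → Fin k) (j : Fin k) →
                 ∃ λ z → (¬ ∃ λ i → ι i ≡ z) × ∃ λ i → (z Vector.∷ ι) i ≡ j
extendingPoint a<k ι j with any? (λ i → ι i ≟ᶠ j)
... | yes (i , ιi≡j) = let z , z∉ι = missedPoint a<k ι in z , z∉ι , suc i , ιi≡j
... | no j∉ι         = j , j∉ι , zero , refl

injectiveCover : ∀ {N k m} (S : Subset N) (f : Fin N → Fin k) → ∣ S ∣ ≤ m → m ≤ k →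
                 ∃ λ (ι : Fin m → Fin k) → Injective _≡_ _≡_ ι × (∀ u → u ∈ S → ∃ λ i → ι i ≡ f u)
injectiveCover [] f _ m≤k = (λ i → inject≤ i m≤k) , inject≤-injective m≤k m≤k _ _ , λ _ ()
injectiveCover (outside ∷ S) f |S|≤m m≤k
  with ι , ι-inj , covers ← injectiveCover S (f ∘ suc) |S|≤m m≤k =
  ι , ι-inj , λ { (suc u) (there u∈S) → covers u u∈S }
injectiveCover {m = suc m} (inside ∷ S) f (s≤s |S|≤m) m<k
  with ι , ι-inj , covers ← injectiveCover S (f ∘ suc) |S|≤m (<⇒≤ m<k)
  with z , z∉ι , f0∈ ← extendingPoint m<k ι (f zero) =
  z Vector.∷ ι , ∷-injective ι-inj z∉ι , λ
    { zero    here        → f0∈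
    ; (suc u) (there u∈S) → let i , ιi≡fu = covers u u∈S in suc i , ιi≡fu }

Agrees : ∀ {n} → Fin n → Subset n → Bool → Set
Agrees x P b = (x ∈ P → b ≡ true) × (b ≡ true → x ∈ P)

-- f[S] may have repetitions, so it is padded to r distinct coordinates before r-independence applies.
realiseOnImage : ∀ {n k r N} (B : Fin k → Subset n) → RIndependentCollection r B → r ≤ k →
                 (S : Subset N) → ∣ S ∣ ≤ r → (f : Fin N → Fin k) (b : Fin k → Bool) →
                 ∃ λ x → ∀ u → u ∈ S → Agrees x (B (f u)) (b (f u))
realiseOnImage B B-independent r≤k S |S|≤r f b
  with ι , ι-inj , covers ← injectiveCover S f |S|≤r r≤k
  with x , agrees ← B-independent ι ι-inj (b ∘ ι) =
  x , λ u u∈S → let i , ιi≡fu = covers u u∈S in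
    subst (λ t → Agrees x (B t) (b t)) ιi≡fu (agrees i)

signed : ∀ {n} → Bool → Subset n → Subset n
signed b P = if b then P else ∁ P

∈-signed : ∀ {n} {x : Fin n} {P b} → Agrees x P b → x ∈ signed b P
∈-signed {b = true}  (_ , b⇒x∈P) = b⇒x∈P refl
∈-signed {b = false} (x∈P⇒b , _) = x∉p⇒x∈∁p λ x∈P → case x∈P⇒b x∈P of λ ()

∉-signed : ∀ {n} {x : Fin n} {P b b′} → Agrees x P b → b′ ≢ b → x ∉ signed b′ P
∉-signed {b = true}  {true}  _             b′≢b = ⊥-elim (b′≢b refl)
∉-signed {b = true}  {false} (_ , b⇒x∈P)   _    = λ x∈∁P → x∈∁p⇒x∉p x∈∁P (b⇒x∈P refl)
∉-signed {b = false} {true}  (x∈P⇒b , _)   _    = λ x∈P → case x∈P⇒b x∈P of λ ()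
∉-signed {b = false} {false} _             b′≢b = ⊥-elim (b′≢b refl)

funToFin-cong : ∀ {m n} {f g : Fin m → Fin n} → f ≗ g → funToFin f ≡ funToFin g
funToFin-cong {zero}  _   = refl
funToFin-cong {suc m} f≗g = cong₂ combine (f≗g zero) (funToFin-cong (f≗g ∘ suc))

finToFun-injective : ∀ {m n} {i j : Fin (m ^ n)} → finToFun i ≗ finToFun j → i ≡ j
finToFun-injective {m} {n} {i} {j} e = begin
  i                             ≡⟨ sym (funToFin-finToFin {n} {m} i) ⟩
  funToFin (finToFun {m} {n} i) ≡⟨ funToFin-cong {n} {m} e ⟩
  funToFin (finToFun {m} {n} j) ≡⟨ funToFin-finToFin {n} {m} j ⟩
  j                             ∎
  where open ≡-Reasoning

bits : ∀ {k} → Fin (2 ^ k) → Fin k → Bool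
bits i t = Injection.to (↔⇒↣ 2↔Bool) (finToFun i t)

bits-injective : ∀ {k} {i j : Fin (2 ^ k)} → bits i ≗ bits j → i ≡ j
bits-injective {k} {i} {j} e = finToFun-injective {2} {k} λ t →
  Injection.injective (↔⇒↣ 2↔Bool) {finToFun {2} {k} i t} {finToFun {2} {k} j t} (e t)

record BitColouring {N : ℕ} (G : Graph N) (k : ℕ) : Set where
  field
    colour     : Fin N → Fin k → Bool
    separator  : Fin N → Fin N → Fin k
    separates  : ∀ {u v} → Adj G u v → colour u (separator u v) ≢ colour v (separator u v)

colourable⇒bitColouring : ∀ {N h k} {G : Graph N} → Colourable G h → h ≤ 2 ^ k → Fin k →
                          BitColouring G k
colourable⇒bitColouring {N} {h} {k} {G} (col , proper) h≤2^k t₀ = record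
  { colour = colour ; separator = separator ; separates = separates }
  where
  colour : Fin N → Fin k → Bool
  colour u = bits (inject≤ (col u) h≤2^k)

  colours-differ : ∀ {u v} → Adj G u v → ∃ λ t → colour u t ≢ colour v t
  colours-differ {u} {v} adj = ¬∀⟶∃¬ k _ (λ t → colour u t ≟ᵇ colour v t) λ same →
    proper u v adj (inject≤-injective h≤2^k h≤2^k _ _ (bits-injective same))

  -- t₀ is only a placeholder for non-adjacent pairs
  separator : Fin N → Fin N → Fin k
  separator u v with any? (λ t → ¬? (colour u t ≟ᵇ colour v t))
  ... | yes (t , _) = t
  ... | no _        = t₀

  separates : ∀ {u v} → Adj G u v → colour u (separator u v) ≢ colour v (separator u v)
  separates {u} {v} adj with any? (λ t → ¬? (colour u t ≟ᵇ colour v t))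
  ... | yes (_ , differ) = differ
  ... | no none          = ⊥-elim (none (colours-differ adj))

module _ {N k} {G : Graph N} (χ : BitColouring G k) where
  open BitColouring χ

  edgeSets : ∀ {n} → (Fin k → Subset n) → Fin N → Fin N → Subset n
  edgeSets B u v = signed (colour v (separator u v)) (B (separator u v))

  edgeCoordinate : Fin N → Fin N → Fin k
  edgeCoordinate v u with u <? v
  ... | yes _ = separator u v
  ... | no  _ = separator v u

  edgeCoordinate-below : ∀ {u v} → u <ᶠ v → edgeCoordinate v u ≡ separator u v
  edgeCoordinate-below {u} {v} u<v with u <? v
  ... | yes _   = refl
  ... | no  u≮v = ⊥-elim (u≮v u<v)

  edgeCoordinate-above : ∀ {u v} → v <ᶠ u → edgeCoordinate v u ≡ separator v u
  edgeCoordinate-above {u} {v} v<u with u <? v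
  ... | yes u<v = ⊥-elim (<-asym u<v v<u)
  ... | no  _   = refl

  edgeSets-independent :
    ∀ {n r} (B : Fin k → Subset n) → RIndependentCollection r B → r ≤ k →
    (F : Fin N → Subset N → Set) → (∀ v S → F v S → (∀ u → u ∈ S → Adj G v u) × ∣ S ∣ ≤ r) →
    IndependentSystem Permutation.id n F (edgeSets B)
  edgeSets-independent {n} B B-independent r≤k F F-valid v S FvS =
    const (x , below , above) , const (x , above)
    where
    neighbours : ∀ u → u ∈ S → Adj G v u
    neighbours = proj₁ (F-valid v S FvS)

    point : ∃ λ x → ∀ u → u ∈ S → Agrees x (B (edgeCoordinate v u)) (colour v (edgeCoordinate v u))
    point = realiseOnImage B B-independent r≤k S (proj₂ (F-valid v S FvS)) (edgeCoordinate v) (colour v)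

    x : Fin n
    x = proj₁ point

    AgreesAt : Fin k → Set
    AgreesAt t = Agrees x (B t) (colour v t)

    below : ∀ u → u ∈ S → u <ᶠ v → x ∈ edgeSets B u v
    below u u∈S u<v = ∈-signed (subst AgreesAt (edgeCoordinate-below u<v) (proj₂ point u u∈S))

    above : ∀ w → w ∈ S → v <ᶠ w → x ∉ edgeSets B v w
    above w w∈S v<w = ∉-signed (subst AgreesAt (edgeCoordinate-above v<w) (proj₂ point w w∈S))
                               (separates (neighbours w w∈S) ∘ sym)

lemma2p7 : (n k r : ℕ) → NonZero n → NonZero k → NonZero r → r ≤ k →
    (∃ λ (B : Fin k → Subset n) → RIndependentCollection r B) →
    {N : ℕ} (G : Graph N) (h : ℕ) → IsChromaticNumber G h → h ≤ 2 ^ k →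
    (F : Fin N → Subset N → Set) →
    (∀ v S → F v S → (∀ u → u ∈ S → Adj G v u) × ∣ S ∣ ≤ r) →
    ∃ λ (σ : Permutation′ N) → ∃ λ (A : Fin N → Fin N → Subset n) →
      IndependentSystem σ n F A
lemma2p7 _ k _ _ k≢0 _ r≤k (B , B-independent) G _ (colouring , _) h≤2^k F F-valid =
  Permutation.id , edgeSets χ B , edgeSets-independent χ B B-independent r≤k F F-valid
  where
  χ : BitColouring G k
  χ = colourable⇒bitColouring colouring h≤2^k (fromℕ< (>-nonZero⁻¹ k {{k≢0}}))
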